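{- Let $G$ be a uniquely $C_4^{+}$-saturated graph with $k\geq 1$ triangles, and let $A$ be the set of all vertices of $G$ that lie in some triangle of $G$. Then $N^{2}(A)=\emptyset$.
   Context: All graphs are finite, simple and undirected. $C_4^{+}$ (the diamond) is the graph obtained from a $4$-cycle by adding one chord, i.e. $K_4$ minus an edge. For a graph $H$, a graph $G$ is uniquely $H$-saturated if $G$ contains no subgraph isomorphic to $H$, but for every pair of non-adjacent vertices $u,v$ of $G$, the graph $G+uv$ contains exactly one subgraph isomorphic to $H$. A triangle is a subgraph isomorphic to $K_3$. For $U\subseteq V(G)$, $d(v,U)=\min\{d(v,u):u\in U\}$ and $N^{2}(U)=\{v\in V(G): d(v,U)=2\}$. -}

module Defs where

open import Level using (0ℓ)
open import Data.Nat using (ℕ; zero; suc; _≤_)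
open import Data.Fin using (Fin; zero; suc)
open import Data.Product using (Σ; ∃; ∃-syntax; _×_; _,_)
open import Data.Sum using (_⊎_)
open import Relation.Nullary using (¬_)
open import Relation.Binary.PropositionalEquality using (_≡_; _≢_)
open import Function.Bundles using (_⇔_)
open import Function.Definitions using (Injective)

record Graph (n : ℕ) : Set₁ where
  field
    Adj    : Fin n → Fin n → Set
    sym    : ∀ {a b} → Adj a b → Adj b a
    irrefl : ∀ {a} → ¬ Adj a a
open Graph public

_+E_ : ∀ {n} → (G : Graph n) → (Σ (Fin n × Fin n) λ { (u , v) → u ≢ v }) → Graph n
Adj (G +E ((u , v) , u≢v)) a b = Adj G a b ⊎ ((a ≡ u × b ≡ v) ⊎ (a ≡ v × b ≡ u))
sym (G +E ((u , v) , u≢v)) (Data.Sum.inj₁ e) = Data.Sum.inj₁ (sym G e)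
sym (G +E ((u , v) , u≢v)) (Data.Sum.inj₂ (Data.Sum.inj₁ (p , q))) = Data.Sum.inj₂ (Data.Sum.inj₂ (q , p))
sym (G +E ((u , v) , u≢v)) (Data.Sum.inj₂ (Data.Sum.inj₂ (p , q))) = Data.Sum.inj₂ (Data.Sum.inj₁ (q , p))
irrefl (G +E ((u , v) , u≢v)) (Data.Sum.inj₁ e) = irrefl G e
irrefl (G +E ((u , v) , u≢v)) (Data.Sum.inj₂ (Data.Sum.inj₁ (Relation.Binary.PropositionalEquality.refl , q))) = u≢v q
irrefl (G +E ((u , v) , u≢v)) (Data.Sum.inj₂ (Data.Sum.inj₂ (Relation.Binary.PropositionalEquality.refl , q))) = u≢v (Relation.Binary.PropositionalEquality.sym q)

-- The diamond C4⁺ = K4 minus an edge, on vertex set Fin 4: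
-- all pairs adjacent except {2,3}.
diamond : Graph 4
Adj diamond a b = (a ≢ b) × ¬ ((a ≡ suc (suc zero) × b ≡ suc (suc (suc zero))) ⊎ (a ≡ suc (suc (suc zero)) × b ≡ suc (suc zero)))
sym diamond (a≢b , ¬p) = (λ e → a≢b (Relation.Binary.PropositionalEquality.sym e)) ,
  λ { (Data.Sum.inj₁ (x , y)) → ¬p (Data.Sum.inj₂ (y , x))
    ; (Data.Sum.inj₂ (x , y)) → ¬p (Data.Sum.inj₁ (y , x)) }
irrefl diamond (a≢a , _) = a≢a Relation.Binary.PropositionalEquality.refl

-- A subgraph of G isomorphic to H, presented by an injective
-- edge-preserving map V(H) → V(G) (its image is the subgraph).
record Copy {m n : ℕ} (H : Graph m) (G : Graph n) : Set where
  field
    f        : Fin m → Fin n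
    f-inj    : Injective _≡_ _≡_ f
    f-edges  : ∀ {i j} → Adj H i j → Adj G (f i) (f j)
open Copy public

ImageEdge : ∀ {m n} {H : Graph m} {G : Graph n} → Copy H G → Fin n → Fin n → Set
ImageEdge {H = H} c a b = ∃[ i ] ∃[ j ] (Adj H i j × f c i ≡ a × f c j ≡ b)

-- Two copies give the same subgraph iff they have the same edge set
-- (H has no isolated vertices here, so the vertex set is determined too;
-- we also require equal vertex sets to be literal).
SameSubgraph : ∀ {m n} {H : Graph m} {G : Graph n} → Copy H G → Copy H G → Set
SameSubgraph c d =
  (∀ a → (∃[ i ] f c i ≡ a) ⇔ (∃[ j ] f d j ≡ a)) ×
  (∀ a b → ImageEdge c a b ⇔ ImageEdge d a b)

Contains : ∀ {m n} → Graph m → Graph n → Set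
Contains H G = Copy H G

ExactlyOne : ∀ {m n} → Graph m → Graph n → Set
ExactlyOne H G = Σ (Copy H G) λ c → ∀ (d : Copy H G) → SameSubgraph c d

UniquelySaturated : ∀ {m n} → Graph m → Graph n → Set
UniquelySaturated H G =
  ¬ Contains H G ×
  (∀ u v → (u≢v : u ≢ v) → ¬ Adj G u v → ExactlyOne H (G +E ((u , v) , u≢v)))

IsTriangle : ∀ {n} → Graph n → Fin n → Fin n → Fin n → Set
IsTriangle G a b c = Adj G a b × Adj G b c × Adj G a c

HasTriangle : ∀ {n} → Graph n → Set
HasTriangle G = ∃[ a ] ∃[ b ] ∃[ c ] IsTriangle G a b c

InTriangle : ∀ {n} → Graph n → Fin n → Set
InTriangle G v = ∃[ b ] ∃[ c ] IsTriangle G v b c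

data Walk {n} (G : Graph n) : ℕ → Fin n → Fin n → Set where
  here : ∀ {a} → Walk G zero a a
  step : ∀ {k a b c} → Adj G a b → Walk G k b c → Walk G (suc k) a c

DistLe : ∀ {n} → Graph n → ℕ → Fin n → Fin n → Set
DistLe G k a b = ∃[ l ] (l ≤ k × Walk G l a b)

DistToSetIs2 : ∀ {n} → Graph n → (Fin n → Set) → Fin n → Set
DistToSetIs2 G U v =
  (∃[ u ] (U u × DistLe G 2 v u)) × ¬ (∃[ u ] (U u × DistLe G 1 v u))

N2Empty : ∀ {n} → Graph n → (Fin n → Set) → Set
N2Empty G U = ∀ v → ¬ DistToSetIs2 G U v

{-# OPTIONS --safe #-}
-- Let v be at distance 2 from A, along v – x – u with u in a triangle ubc. In a
-- uniquely C₄⁺-saturated graph two non-adjacent vertices have at most two common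
-- neighbours, and the diamond created by adding pq either has pq as its chord (so p, q
-- have two common neighbours) or as a rim edge (so some common neighbour of p, q lies in
-- a triangle). As neither v nor its neighbours lie in triangles, this gives a map on
-- Far = {q ∉ N[v] : q ≁ x}: q has exactly two common neighbours y, z with v; x and y have
-- a common neighbour t_y ≠ v, which determines y; and t_y, t_z have a common neighbour
-- r ≠ x, which is Far and determines {t_y, t_z}. So the map is injective, but b is Far
-- and not in its image, contradicting finiteness.
module Submission where

open import Defs
open import Data.Nat using (ℕ; _≤_; z≤n; s≤s)
open import Data.Nat.Properties using (n<1+n)
open import Data.Fin using (Fin; zero; suc; punchOut)
open import Data.Fin.Properties using (_≟_; punchOut-injective; <⇒notInjective)
open import Data.Product using (∃; ∃₂; _×_; _,_; proj₁; proj₂)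
import Data.Product as Product
open import Data.Sum using (_⊎_; inj₁; inj₂)
import Data.Sum as Sum
open import Data.Empty using (⊥; ⊥-elim)
open import Function using (_∘_)
open import Function.Bundles using (Equivalence)
open import Function.Definitions using (Injective)
open import Relation.Nullary using (¬_; Dec; yes; no)
open import Relation.Nullary.Decidable
  using (False; toWitnessFalse; _×-dec_; _⊎-dec_; ¬¬-excluded-middle)
open import Relation.Binary.PropositionalEquality
  using (_≡_; _≢_; refl; subst; ≢-sym) renaming (sym to ≡-sym)

private
  variable
    n : ℕ

pattern 0F = zero
pattern 1F = suc zero
pattern 2F = suc (suc zero)
pattern 3F = suc (suc (suc zero))

SameEdge : {A : Set} → A → A → A → A → Set
SameEdge a b c d = (a ≡ c × b ≡ d) ⊎ (a ≡ d × b ≡ c)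

sameEdge? : (i j k l : Fin n) → Dec (SameEdge i j k l)
sameEdge? i j k l = (i ≟ k ×-dec j ≟ l) ⊎-dec (i ≟ l ×-dec j ≟ k)

SameEdge-sym : {A : Set} {a b c d : A} → SameEdge a b c d → SameEdge c d a b
SameEdge-sym (inj₁ (refl , refl)) = inj₁ (refl , refl)
SameEdge-sym (inj₂ (refl , refl)) = inj₂ (refl , refl)

SameEdge-trans : {A : Set} {a b c d e f : A} →
  SameEdge a b c d → SameEdge c d e f → SameEdge a b e f
SameEdge-trans (inj₁ (refl , refl)) cd=ef = cd=ef
SameEdge-trans (inj₂ (refl , refl)) (inj₁ (refl , refl)) = inj₂ (refl , refl)
SameEdge-trans (inj₂ (refl , refl)) (inj₂ (refl , refl)) = inj₁ (refl , refl)

SameEdge-injective : {A B : Set} {g : A → B} → Injective _≡_ _≡_ g →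
  ∀ {a b c d} → SameEdge (g a) (g b) (g c) (g d) → SameEdge a b c d
SameEdge-injective g-inj = Sum.map (Product.map g-inj g-inj) (Product.map g-inj g-inj)

pair-⊆ : {A : Set} {P : A → Set} {a b c d : A} → c ≢ d →
  c ≡ a ⊎ c ≡ b → d ≡ a ⊎ d ≡ b → P c → P d → P a × P b
pair-⊆ _   (inj₁ refl) (inj₂ refl) Pc Pd = Pc , Pd
pair-⊆ _   (inj₂ refl) (inj₁ refl) Pc Pd = Pd , Pc
pair-⊆ c≢d (inj₁ refl) (inj₁ refl) _  _  = ⊥-elim (c≢d refl)
pair-⊆ c≢d (inj₂ refl) (inj₂ refl) _  _  = ⊥-elim (c≢d refl)

adj⇒≢ : (G : Graph n) {a b : Fin n} → Adj G a b → a ≢ b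
adj⇒≢ G a~b refl = irrefl G a~b

CommonNeighbour : Graph n → Fin n → Fin n → Fin n → Set
CommonNeighbour G p q s = Adj G p s × Adj G q s

InImage : {m : ℕ} {H : Graph m} {G : Graph n} → Copy H G → Fin n → Set
InImage c a = ∃ λ i → f c i ≡ a

ExactlyOne⇒sameVertices : {m : ℕ} {H : Graph m} {G : Graph n} → ExactlyOne H G →
  (c d : Copy H G) → ∀ {a} → InImage c a → InImage d a
ExactlyOne⇒sameVertices (_ , unique) c d {a} a∈c =
  Equivalence.to (proj₁ (unique d) a) (Equivalence.from (proj₁ (unique c) a) a∈c)

quad : Fin n → Fin n → Fin n → Fin n → Fin 4 → Fin n
quad a b c d 0F = a
quad a b c d 1F = b
quad a b c d 2F = c
quad a b c d 3F = d

∉-quad : {a b c d e : Fin n} → e ≢ a → e ≢ b → e ≢ c → e ≢ d →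
  ¬ (∃ λ i → quad a b c d i ≡ e)
∉-quad e≢a _ _ _ (0F , refl) = e≢a refl
∉-quad _ e≢b _ _ (1F , refl) = e≢b refl
∉-quad _ _ e≢c _ (2F , refl) = e≢c refl
∉-quad _ _ _ e≢d (3F , refl) = e≢d refl

diamond-adj : (i j : Fin 4) {_ : False (i ≟ j)} {_ : False (sameEdge? i j 2F 3F)} →
  Adj diamond i j
diamond-adj i j {i≢j} {ij≠23} = toWitnessFalse i≢j , toWitnessFalse ij≠23

module _ (H : Graph n) {a b c d : Fin n}
  (a~b : Adj H a b) (a~c : Adj H a c) (a~d : Adj H a d) (b~c : Adj H b c) (b~d : Adj H b d)
  where

  quad-edges : ∀ {i j} → Adj diamond i j → Adj H (quad a b c d i) (quad a b c d j)
  quad-edges {0F} {1F} _ = a~b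
  quad-edges {0F} {2F} _ = a~c
  quad-edges {0F} {3F} _ = a~d
  quad-edges {1F} {0F} _ = sym H a~b
  quad-edges {1F} {2F} _ = b~c
  quad-edges {1F} {3F} _ = b~d
  quad-edges {2F} {0F} _ = sym H a~c
  quad-edges {2F} {1F} _ = sym H b~c
  quad-edges {3F} {0F} _ = sym H a~d
  quad-edges {3F} {1F} _ = sym H b~d
  quad-edges {2F} {3F} (_ , ij≠23) = ⊥-elim (ij≠23 (inj₁ (refl , refl)))
  quad-edges {3F} {2F} (_ , ij≠23) = ⊥-elim (ij≠23 (inj₂ (refl , refl)))
  quad-edges {0F} {0F} (i≢j , _) = ⊥-elim (i≢j refl)
  quad-edges {1F} {1F} (i≢j , _) = ⊥-elim (i≢j refl)
  quad-edges {2F} {2F} (i≢j , _) = ⊥-elim (i≢j refl)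
  quad-edges {3F} {3F} (i≢j , _) = ⊥-elim (i≢j refl)

  diamond-copy : c ≢ d → Copy diamond H
  diamond-copy c≢d = record { f = quad a b c d ; f-inj = injective ; f-edges = quad-edges }
    where
    -- Distinct indices are adjacent in the diamond, except for the pair {2, 3}.
    injective : Injective _≡_ _≡_ (quad a b c d)
    injective {i} {j} qi≡qj with i ≟ j | sameEdge? i j 2F 3F
    ... | yes i≡j | _                       = i≡j
    ... | no _    | yes (inj₁ (refl , refl)) = ⊥-elim (c≢d qi≡qj)
    ... | no _    | yes (inj₂ (refl , refl)) = ⊥-elim (c≢d (≡-sym qi≡qj))
    ... | no i≢j  | no ij≠23                 = ⊥-elim (adj⇒≢ H (quad-edges (i≢j , ij≠23)) qi≡qj)

chord-copy : (G : Graph n) {p q s t : Fin n} (p≢q : p ≢ q) → s ≢ t →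
  CommonNeighbour G p q s → CommonNeighbour G p q t → Copy diamond (G +E ((p , q) , p≢q))
chord-copy G p≢q s≢t (p~s , q~s) (p~t , q~t) =
  diamond-copy (G +E (_ , p≢q)) (inj₂ (inj₁ (refl , refl)))
    (inj₁ p~s) (inj₁ p~t) (inj₁ q~s) (inj₁ q~t) s≢t

data NewDiamond (G : Graph n) (p q : Fin n) : Set where
  chord : ∀ {s t} → s ≢ t → CommonNeighbour G p q s → CommonNeighbour G p q t → NewDiamond G p q
  rim   : ∀ {s} → CommonNeighbour G p q s → InTriangle G s → NewDiamond G p q

SameEdge⇒commonNeighbour : (G : Graph n) {a b p q s : Fin n} →
  SameEdge a b p q → Adj G a s → Adj G b s → CommonNeighbour G p q s
SameEdge⇒commonNeighbour G (inj₁ (refl , refl)) a~s b~s = a~s , b~s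
SameEdge⇒commonNeighbour G (inj₂ (refl , refl)) a~s b~s = b~s , a~s

-- s a t is a triangle and b a pendant vertex at s; the added edge is ab.
rim-edge : (G : Graph n) {a b p q s t : Fin n} → SameEdge a b p q →
  Adj G s a → Adj G s b → Adj G a t → Adj G s t → NewDiamond G p q
rim-edge G ab=pq s~a s~b a~t s~t =
  rim (SameEdge⇒commonNeighbour G ab=pq (sym G s~a) (sym G s~b)) (_ , _ , s~a , a~t , s~t)

module _ {G : Graph n} {p q : Fin n} {p≢q : p ≢ q}
  (c : Copy diamond (G +E ((p , q) , p≢q))) where

  private
    F : Fin 4 → Fin n
    F = f c

    F-2≢3 : F 2F ≢ F 3F
    F-2≢3 F2≡F3 with f-inj c F2≡F3
    ... | ()

    data New (i j : Fin 4) : Set where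
      new : SameEdge (F i) (F j) p q → New i j

    edge : ∀ i j {_ : False (i ≟ j)} {_ : False (sameEdge? i j 2F 3F)} →
      Adj G (F i) (F j) ⊎ New i j
    edge i j {i≢j} {ij≠23} = Sum.map₂ new (f-edges c (diamond-adj i j {i≢j} {ij≠23}))

    -- Since F is injective, at most one edge of the diamond lands on pq. The implicit
    -- side conditions reduce to ⊤ for concrete indices and are filled in automatically.
    old : ∀ {i j} → New i j → ∀ k l {_ : False (k ≟ l)} {_ : False (sameEdge? k l 2F 3F)}
      {_ : False (sameEdge? k l i j)} → Adj G (F k) (F l)
    old (new ij=pq) k l {k≢l} {kl≠23} {kl≠ij} with edge k l {k≢l} {kl≠23}
    ... | inj₁ Fk~Fl = Fk~Fl
    ... | inj₂ (new kl=pq) = ⊥-elim (toWitnessFalse kl≠ij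
          (SameEdge-injective (f-inj c) (SameEdge-trans kl=pq (SameEdge-sym ij=pq))))

  new-diamond : ¬ Copy diamond G → NewDiamond G p q
  new-diamond diamond-free with edge 0F 1F
  ... | inj₂ n@(new 01=pq) =
    chord F-2≢3 (SameEdge⇒commonNeighbour G 01=pq (old n 0F 2F) (old n 1F 2F))
                (SameEdge⇒commonNeighbour G 01=pq (old n 0F 3F) (old n 1F 3F))
  ... | inj₁ g01 with edge 0F 2F
  ...   | inj₂ n@(new 02=pq) =
    rim-edge G 02=pq (sym G g01) (old n 1F 2F) (old n 0F 3F) (old n 1F 3F)
  ...   | inj₁ g02 with edge 0F 3F
  ...     | inj₂ n@(new 03=pq) = rim-edge G 03=pq (sym G g01) (old n 1F 3F) g02 (old n 1F 2F)
  ...     | inj₁ g03 with edge 1F 2F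
  ...       | inj₂ n@(new 12=pq) = rim-edge G 12=pq g01 g02 (old n 1F 3F) g03
  ...       | inj₁ g12 with edge 1F 3F
  ...         | inj₂ (new 13=pq) = rim-edge G 13=pq g01 g03 g12 g02
  ...         | inj₁ g13 = ⊥-elim (diamond-free (diamond-copy G g01 g02 g03 g12 g13 F-2≢3))

module Saturated {G : Graph n} (sat : UniquelySaturated diamond G) where

  private
    the-diamond : ∀ {p q} (p≢q : p ≢ q) → ¬ Adj G p q → ExactlyOne diamond (G +E ((p , q) , p≢q))
    the-diamond = proj₂ sat _ _

  same-vertices : ∀ {p q} (p≢q : p ≢ q) → ¬ Adj G p q →
    (c d : Copy diamond (G +E ((p , q) , p≢q))) → ∀ {a} → InImage c a → InImage d a
  same-vertices p≢q p≁q = ExactlyOne⇒sameVertices (the-diamond p≢q p≁q)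

  added-edge-diamond : ∀ {p q} → p ≢ q → ¬ Adj G p q → NewDiamond G p q
  added-edge-diamond p≢q p≁q = new-diamond (proj₁ (the-diamond p≢q p≁q)) (proj₁ sat)

  common-neighbours-≤2 : ∀ {p q y z w} → p ≢ q → ¬ Adj G p q → y ≢ z →
    CommonNeighbour G p q y → CommonNeighbour G p q z → CommonNeighbour G p q w →
    w ≡ y ⊎ w ≡ z
  -- A third common neighbour w would give two diamonds, with tips {y, z} and {y, w}.
  common-neighbours-≤2 {y = y} {z} {w} p≢q p≁q y≢z cy cz cw with w ≟ y | w ≟ z
  ... | yes w≡y | _       = inj₁ w≡y
  ... | no _    | yes w≡z = inj₂ w≡z
  ... | no w≢y  | no w≢z  = ⊥-elim (
    ∉-quad (≢-sym (adj⇒≢ G (proj₁ cz))) (≢-sym (adj⇒≢ G (proj₂ cz))) (≢-sym y≢z) (≢-sym w≢z)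
      (same-vertices p≢q p≁q (chord-copy G p≢q y≢z cy cz) (chord-copy G p≢q (≢-sym w≢y) cy cw)
        (3F , refl)))

  common-neighbour-avoiding : ∀ {p q a} → p ≢ q → ¬ Adj G p q → ¬ InTriangle G a →
    ∃ λ s → CommonNeighbour G p q s × s ≢ a
  common-neighbour-avoiding {a = a} p≢q p≁q a∉A with added-edge-diamond p≢q p≁q
  ... | rim {s} cs s∈A = s , cs , λ { refl → a∉A s∈A }
  ... | chord {s} {t} s≢t cs ct with s ≟ a
  ...   | yes refl = t , ct , ≢-sym s≢t
  ...   | no s≢a   = s , cs , s≢a

  two-common-neighbours : ∀ {p q} → p ≢ q → ¬ Adj G p q →
    (∀ {s} → CommonNeighbour G p q s → ¬ InTriangle G s) →
    ∃₂ λ s t → s ≢ t × CommonNeighbour G p q s × CommonNeighbour G p q t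
  two-common-neighbours p≢q p≁q ∉A with added-edge-diamond p≢q p≁q
  ... | chord s≢t cs ct = _ , _ , s≢t , cs , ct
  ... | rim cs s∈A      = ⊥-elim (∉A cs s∈A)

¬¬-∀-Fin : {P : Fin n → Set} → (∀ i → ¬ ¬ P i) → ¬ ¬ (∀ i → P i)
¬¬-∀-Fin {ℕ.zero}  _  k = k (λ ())
¬¬-∀-Fin {ℕ.suc n} {P} ¬¬P k =
  ¬¬P zero λ P₀ → ¬¬-∀-Fin {P = P ∘ suc} (¬¬P ∘ suc) λ P₊ → k λ { zero → P₀ ; (suc i) → P₊ i }

injective⇒¬avoids : {φ : Fin n → Fin n} → Injective _≡_ _≡_ φ → ∀ b → ¬ (∀ i → φ i ≢ b)
injective⇒¬avoids {ℕ.suc n} {φ} φ-inj b avoids = <⇒notInjective (n<1+n n) φ′-inj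
  where
  φ′ : Fin (ℕ.suc n) → Fin n
  φ′ i = punchOut (≢-sym (avoids i))
  φ′-inj : Injective _≡_ _≡_ φ′
  φ′-inj {i} {j} = φ-inj ∘ punchOut-injective (≢-sym (avoids i)) (≢-sym (avoids j))

-- P need not be decidable: the conclusion is a negation, so excluded middle may be
-- assumed for each of the finitely many P q.
total-injective⇒surjective : {P : Fin n → Set} {R : Fin n → Fin n → Set} →
  (∀ {q} → P q → ∃ λ r → P r × R q r) →
  (∀ {q₁ q₂ r} → P q₁ → P q₂ → P r → R q₁ r → R q₂ r → q₁ ≡ q₂) →
  ∀ {b} → P b → ¬ (∀ q → ¬ R q b)
total-injective⇒surjective {n} {P} {R} total injective {b} Pb unhit =
  ¬¬-∀-Fin (λ _ → ¬¬-excluded-middle) λ P? →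
    injective⇒¬avoids (λ {i} {j} → extend-injective (P? i) (P? j)) b (extend-avoids ∘ P?)
  where
  extend : ∀ q → Dec (P q) → Fin n
  extend q (yes Pq) = proj₁ (total Pq)
  extend q (no _)   = q

  extend-injective : ∀ {q₁ q₂} (d₁ : Dec (P q₁)) (d₂ : Dec (P q₂)) →
    extend q₁ d₁ ≡ extend q₂ d₂ → q₁ ≡ q₂
  extend-injective (yes P₁) (yes P₂) e with total P₁ | total P₂
  ... | _ , Pr , R₁ | _ , _ , R₂ = injective P₁ P₂ Pr R₁ (subst (R _) (≡-sym e) R₂)
  extend-injective (yes P₁) (no ¬P₂) refl = ⊥-elim (¬P₂ (proj₁ (proj₂ (total P₁))))
  extend-injective (no ¬P₁) (yes P₂) refl = ⊥-elim (¬P₁ (proj₁ (proj₂ (total P₂))))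
  extend-injective (no _)   (no _)   e    = e

  extend-avoids : ∀ {q} (d : Dec (P q)) → extend q d ≢ b
  extend-avoids (yes Pq) refl = unhit _ (proj₂ (proj₂ (total Pq)))
  extend-avoids (no ¬Pq) refl = ¬Pq Pb

module DistanceTwo {G : Graph n} (sat : UniquelySaturated diamond G)
  {v x : Fin n} (v~x : Adj G v x)
  (v∉A : ¬ InTriangle G v) (v-neighbours-∉A : ∀ {y} → Adj G v y → ¬ InTriangle G y) where

  open Saturated sat

  x∉A : ¬ InTriangle G x
  x∉A = v-neighbours-∉A v~x

  v-neighbours-nonadjacent : ∀ {a b} → Adj G v a → Adj G v b → ¬ Adj G a b
  v-neighbours-nonadjacent v~a v~b a~b = v∉A (_ , _ , v~a , a~b , v~b)

  x-neighbour-≁v : ∀ {t} → Adj G x t → ¬ Adj G v t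
  x-neighbour-≁v x~t v~t = v∉A (_ , _ , v~x , x~t , v~t)

  Far : Fin n → Set
  Far q = q ≢ v × ¬ Adj G v q × ¬ Adj G x q

  Far⇒≢x : ∀ {q} → Far q → q ≢ x
  Far⇒≢x (_ , v≁q , _) refl = v≁q v~x

  record Link (y t : Fin n) : Set where
    field
      v~y : Adj G v y
      y≢x : y ≢ x
      x~t : Adj G x t
      y~t : Adj G y t
      t≢v : t ≢ v

  link : ∀ {y} → Adj G v y → y ≢ x → ∃ (Link y)
  link v~y y≢x
    with t , (x~t , y~t) , t≢v ← common-neighbour-avoiding (≢-sym y≢x)
                                   (v-neighbours-nonadjacent v~x v~y) v∉A
    = t , record { v~y = v~y ; y≢x = y≢x ; x~t = x~t ; y~t = y~t ; t≢v = t≢v }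

  link-common-neighbours : ∀ {y t w} → Link y t → Adj G v w → Adj G t w → w ≡ x ⊎ w ≡ y
  link-common-neighbours L v~w t~w =
    common-neighbours-≤2 (≢-sym t≢v) (x-neighbour-≁v x~t) (≢-sym y≢x)
      (v~x , sym G x~t) (v~y , sym G y~t) (v~w , t~w)
    where open Link L

  link-injective : ∀ {y y′ t} → Link y t → Link y′ t → y ≡ y′
  link-injective L L′ with link-common-neighbours L (Link.v~y L′) (sym G (Link.y~t L′))
  ... | inj₁ y′≡x = ⊥-elim (Link.y≢x L′ y′≡x)
  ... | inj₂ y′≡y = ≡-sym y′≡y

  links-≢ : ∀ {y z ty tz} → Link y ty → Link z tz → y ≢ z → ty ≢ tz
  links-≢ Ly Lz y≢z refl = y≢z (link-injective Ly Lz)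

  links-nonadjacent : ∀ {y z ty tz} → Link y ty → Link z tz → ¬ Adj G ty tz
  links-nonadjacent Ly Lz ty~tz = x∉A (_ , _ , Link.x~t Ly , ty~tz , Link.x~t Lz)

  links-common-neighbour-far : ∀ {y z ty tz r} → Link y ty → Link z tz → y ≢ z →
    CommonNeighbour G ty tz r → r ≢ x → Far r
  links-common-neighbour-far {r = r} Ly Lz y≢z (ty~r , tz~r) r≢x = r≢v , v≁r , x≁r
    where
    r≢v : r ≢ v
    r≢v refl = x-neighbour-≁v (Link.x~t Ly) (sym G ty~r)
    v≁r : ¬ Adj G v r
    v≁r v~r with link-common-neighbours Ly v~r ty~r | link-common-neighbours Lz v~r tz~r
    ... | inj₁ r≡x  | _        = r≢x r≡x
    ... | _         | inj₁ r≡x = r≢x r≡x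
    ... | inj₂ refl | inj₂ r≡z = y≢z r≡z
    x≁r : ¬ Adj G x r
    x≁r x~r = x∉A (_ , _ , Link.x~t Ly , ty~r , x~r)

  links-successor : ∀ {y z ty tz} → Link y ty → Link z tz → y ≢ z →
    ∃ λ r → Far r × CommonNeighbour G ty tz r
  links-successor Ly Lz y≢z
    with r , c , r≢x ← common-neighbour-avoiding (links-≢ Ly Lz y≢z) (links-nonadjacent Ly Lz) x∉A
    = r , links-common-neighbour-far Ly Lz y≢z c r≢x , c

  record Successor (q r : Fin n) : Set where
    field
      y z ty tz : Fin n
      y≢z : y ≢ z
      q~y : Adj G q y
      q~z : Adj G q z
      link-y : Link y ty
      link-z : Link z tz
      ty~r : Adj G ty r
      tz~r : Adj G tz r

  successor : ∀ {q} → Far q → ∃ λ r → Far r × Successor q r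
  successor (q≢v , v≁q , x≁q)
    with y , z , y≢z , (v~y , q~y) , (v~z , q~z)
           ← two-common-neighbours (≢-sym q≢v) v≁q (v-neighbours-∉A ∘ proj₁)
    with ty , Ly ← link v~y (λ { refl → x≁q (sym G q~y) })
       | tz , Lz ← link v~z (λ { refl → x≁q (sym G q~z) })
    with r , far-r , (ty~r , tz~r) ← links-successor Ly Lz y≢z
    = r , far-r , record { y≢z = y≢z ; q~y = q~y ; q~z = q~z ; link-y = Ly ; link-z = Lz
                         ; ty~r = ty~r ; tz~r = tz~r }

  successor-link : ∀ {q r w t} → Far r → (S : Successor q r) → Link w t → Adj G t r →
    w ≡ Successor.y S ⊎ w ≡ Successor.z S
  successor-link far-r S L t~r =
    Sum.map (λ { refl → link-injective L link-y }) (λ { refl → link-injective L link-z })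
      (common-neighbours-≤2 (≢-sym (Far⇒≢x far-r)) (proj₂ (proj₂ far-r))
        (links-≢ link-y link-z y≢z)
        (Link.x~t link-y , sym G ty~r) (Link.x~t link-z , sym G tz~r) (Link.x~t L , sym G t~r))
    where open Successor S

  successor-pair : ∀ {q₁ q₂ r} → Far r → (S₁ : Successor q₁ r) → Successor q₂ r →
    CommonNeighbour G (Successor.y S₁) (Successor.z S₁) q₂
  successor-pair far-r S₁ S₂ =
    pair-⊆ {P = λ s → Adj G s _} y≢z
      (successor-link far-r S₁ link-y ty~r) (successor-link far-r S₁ link-z tz~r)
      (sym G q~y) (sym G q~z)
    where open Successor S₂

  successor-injective : ∀ {q₁ q₂ r} → Far q₁ → Far q₂ → Far r →
    Successor q₁ r → Successor q₂ r → q₁ ≡ q₂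
  successor-injective (q₁≢v , _) (q₂≢v , _) far-r S₁ S₂ =
    Sum.[ ⊥-elim ∘ q₂≢v , ≡-sym ]′
      (common-neighbours-≤2 y≢z (v-neighbours-nonadjacent (Link.v~y link-y) (Link.v~y link-z))
        (≢-sym q₁≢v) (sym G (Link.v~y link-y) , sym G (Link.v~y link-z)) (sym G q~y , sym G q~z)
        (successor-pair far-r S₁ S₂))
    where open Successor S₁

  -- Adding xb would create both the diamond with chord xb and tips ty, tz
  -- and the diamond with chord ub and tips x, c.
  triangle-¬successor : ∀ {u b c q} → Adj G x u → IsTriangle G u b c → ¬ Successor q b
  triangle-¬successor {u} {b} {c} x~u (u~b , b~c , u~c) S =
    ∉-quad c≢x (≢-sym (adj⇒≢ G b~c)) c≢ty c≢tz
      (same-vertices x≢b x≁b chord-ub chord-xb (3F , refl))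
    where
    open Successor S
    x≢b : x ≢ b
    x≢b refl = x∉A (_ , _ , sym G u~b , u~c , b~c)
    x≁b : ¬ Adj G x b
    x≁b x~b = x∉A (_ , _ , x~u , u~b , x~b)
    c≢x : c ≢ x
    c≢x refl = x∉A (_ , _ , sym G u~c , u~b , sym G b~c)
    x≁c : ¬ Adj G x c
    x≁c x~c = x∉A (_ , _ , x~u , u~c , x~c)
    c≢ty : c ≢ ty
    c≢ty refl = x≁c (Link.x~t link-y)
    c≢tz : c ≢ tz
    c≢tz refl = x≁c (Link.x~t link-z)
    chord-xb chord-ub : Copy diamond (G +E ((x , b) , x≢b))
    chord-xb = chord-copy G x≢b (links-≢ link-y link-z y≢z)
      (Link.x~t link-y , sym G ty~r) (Link.x~t link-z , sym G tz~r)
    chord-ub = diamond-copy (G +E _) (inj₁ u~b) (inj₁ (sym G x~u)) (inj₁ u~c)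
      (inj₂ (inj₂ (refl , refl))) (inj₁ b~c) (≢-sym c≢x)

  x-neighbours-∉A : ∀ {u} → Adj G x u → ¬ InTriangle G u
  x-neighbours-∉A x~u (b , c , u~b , b~c , u~c) =
    total-injective⇒surjective successor successor-injective far-b
      (λ _ → triangle-¬successor x~u (u~b , b~c , u~c))
    where
    b∈A : InTriangle G b
    b∈A = _ , _ , sym G u~b , u~c , b~c
    far-b : Far b
    far-b = (λ { refl → v∉A b∈A }) , (λ v~b → v-neighbours-∉A v~b b∈A) ,
            (λ x~b → x∉A (_ , _ , x~u , u~b , x~b))

theorem3p3 : ∀ (n : ℕ) (G : Graph n) → UniquelySaturated diamond G →
    HasTriangle G → N2Empty G (InTriangle G)
theorem3p3 n G sat _ v ((u , u∈A , _ , l≤2 , v⇝u) , ¬near) = walk-impossible v⇝u l≤2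
  where
  v∉A : ¬ InTriangle G v
  v∉A v∈A = ¬near (v , v∈A , 0 , z≤n , here)
  v-neighbours-∉A : ∀ {y} → Adj G v y → ¬ InTriangle G y
  v-neighbours-∉A v~y y∈A = ¬near (_ , y∈A , 1 , s≤s z≤n , step v~y here)
  walk-impossible : ∀ {l} → Walk G l v u → l ≤ 2 → ⊥
  walk-impossible here _ = v∉A u∈A
  walk-impossible (step v~u here) _ = v-neighbours-∉A v~u u∈A
  walk-impossible (step v~x (step x~u here)) _ =
    DistanceTwo.x-neighbours-∉A sat v~x v∉A v-neighbours-∉A x~u u∈A
  walk-impossible (step _ (step _ (step _ _))) (s≤s (s≤s ()))
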